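{- For all integers $n$, $r$ and $k$ with $n\ge r\ge 1$, $$\sum_{j=r}^n\left\{{n\atop j}\right\}_r\widehat c_j^{(k)}=\sum_{\ell=1}^{r}\frac{(-1)^{n}}{(n-r+\ell+1)^k}\left[{r\atop \ell}\right].$$
   Context: For an integer $k$, the poly-Cauchy numbers of the second kind $\widehat c_n^{(k)}$ are defined by $\mathrm{Lif}_k(-\log(1+x))=\sum_{n\ge0}\widehat c_n^{(k)}x^n/n!$, where $\mathrm{Lif}_k(z)=\sum_{m\ge0}\frac{z^m}{m!(m+1)^k}$. $\left[{n\atop m}\right]$ denotes the unsigned Stirling number of the first kind, defined by $x(x+1)\cdots(x+n-1)=\sum_{m}\left[{n\atop m}\right]x^m$. For $r\ge 0$, the $r$-Stirling number of the second kind $\left\{{n\atop m}\right\}_r$ is the number of ways to partition $\{1,\dots,n\}$ into $m$ nonempty disjoint blocks such that $1,\dots,r$ lie in distinct blocks; equivalently $\left\{{n\atop m}\right\}_r=0$ for $n<r$, $\left\{{r\atop m}\right\}_r=\delta_{m,r}$, and $\left\{{n\atop m}\right\}_r=m\left\{{n-1\atop m}\right\}_r+\left\{{n-1\atop m-1}\right\}_r$ for $n>r$. -}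

module Defs where

open import Data.Nat using (ℕ; zero; suc; _∸_) renaming (_*_ to _*ℕ_; _+_ to _+ℕ_)
open import Data.Integer using (ℤ; +_; -[1+_])
open import Data.Rational using (ℚ; 0ℚ; 1ℚ; _/_; _+_; _*_; -_)

ℕ→ℚ : ℕ → ℚ
ℕ→ℚ n = + n / 1

sumBelow : ℕ → (ℕ → ℚ) → ℚ
sumBelow zero    f = 0ℚ
sumBelow (suc n) f = sumBelow n f + f n

-- Σ_{i=a}^{b} f i  (empty if b < a)
sumFromTo : ℕ → ℕ → (ℕ → ℚ) → ℚ
sumFromTo a b f = sumBelow (suc b ∸ a) (λ i → f (a +ℕ i))

sgn : ℕ → ℚ
sgn zero    = 1ℚ
sgn (suc n) = - sgn n

invFact : ℕ → ℚ
invFact zero    = 1ℚ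
invFact (suc m) = invFact m * (+ 1 / suc m)

factℚ : ℕ → ℚ
factℚ zero    = 1ℚ
factℚ (suc m) = factℚ m * ℕ→ℚ (suc m)

invPowNat : ℕ → ℕ → ℚ
invPowNat m zero    = 1ℚ
invPowNat m (suc a) = invPowNat m a * (+ 1 / suc m)

powNat : ℕ → ℕ → ℚ
powNat m zero    = 1ℚ
powNat m (suc a) = powNat m a * ℕ→ℚ (suc m)

-- 1 / (m+1)^k  for an integer exponent k
invPowZ : ℤ → ℕ → ℚ
invPowZ (+ a)      m = invPowNat m a
invPowZ -[1+ a ]   m = powNat m (suc a)

Series : Set
Series = ℕ → ℚ

_⊛_ : Series → Series → Series
(f ⊛ g) n = sumBelow (suc n) (λ i → f i * g (n ∸ i))

powS : Series → ℕ → Series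
powS f zero    zero    = 1ℚ
powS f zero    (suc n) = 0ℚ
powS f (suc m)         = f ⊛ powS f m

negLog1p : Series
negLog1p zero    = 0ℚ
negLog1p (suc j) = sgn (suc j) * (+ 1 / suc j)

-- Poly-Cauchy numbers of the second kind:
--   Lif_k(-log(1+x)) = Σ_n ĉ_n^{(k)} x^n / n!,  Lif_k(z) = Σ_m z^m / (m! (m+1)^k).
-- ĉ_n^{(k)} = n! · [x^n] Σ_m (-log(1+x))^m / (m! (m+1)^k); since -log(1+x) has no
-- constant term, only m ≤ n contribute to [x^n].
polyCauchy2 : ℤ → ℕ → ℚ
polyCauchy2 k n =
  factℚ n * sumFromTo 0 n (λ m → invFact m * invPowZ k m * powS negLog1p m n)

-- Unsigned Stirling numbers of the first kind [n m]: coefficient of x^m in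
-- x(x+1)...(x+n-1); multiplying by (x+n) gives the recursion below.
stirling1 : ℕ → ℕ → ℕ
stirling1 zero    zero    = 1
stirling1 zero    (suc m) = 0
stirling1 (suc n) zero    = n *ℕ stirling1 n zero
stirling1 (suc n) (suc m) = n *ℕ stirling1 n (suc m) +ℕ stirling1 n m

-- r-Stirling numbers of the second kind {n m}_r, via the defining recursion:
-- {n m}_r = 0 for n < r, {r m}_r = δ_{m,r},
-- {n m}_r = m {n-1 m}_r + {n-1 m-1}_r for n > r.
-- Written with d = n - r (n = r + d).
rStirlingAux : ℕ → ℕ → ℕ → ℕ
rStirlingAux r zero    m = δ r m
  where
  δ : ℕ → ℕ → ℕ
  δ zero    zero    = 1
  δ zero    (suc _) = 0
  δ (suc _) zero    = 0
  δ (suc a) (suc b) = δ a b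
rStirlingAux r (suc d) zero    = 0 *ℕ rStirlingAux r d zero
rStirlingAux r (suc d) (suc m) = suc m *ℕ rStirlingAux r d (suc m) +ℕ rStirlingAux r d m

open import Data.Nat using (_<ᵇ_)
open import Data.Bool using (if_then_else_)

rStirling2 : ℕ → ℕ → ℕ → ℕ
rStirling2 r n m = if n <ᵇ r then 0 else rStirlingAux r (n ∸ r) m

{-# OPTIONS --safe #-}
-- Write L = -log(1+x) and θ = (1 + x) d/dx. Since θ is a derivation with θL = -1, we get
-- θ(L^(m+1)) = -(m+1) L^m, and comparing coefficients gives n!/m! [x^n] L^m = (-1)^n [n m].
-- Hence ĉ_j^(k) = (-1)^j S_j(w) with S_j(w) = Σ_m [j m] w_m and w_m = (m+1)^(-k).
-- Against the weights {n j}_r the r-Stirling recurrence transposes onto the Stirling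
-- recurrence S_(j+1)(w) = S_j(w(· + 1)) + j S_j(w), so induction on n - r collapses
-- Σ_j {n j}_r (-1)^j S_j(w) to (-1)^n S_r(w(· + n - r)); its m = 0 term vanishes as r ≥ 1.
module Submission where

module RationalSums where
  open import Defs
  open import Data.Nat as ℕ using (ℕ; zero; suc; _∸_; _<_; _≤_)
  import Data.Nat.Properties as ℕ
  open import Data.Integer as ℤ using (+_)
  import Data.Integer.Properties as ℤ
  open import Data.Rational using (ℚ; mkℚ; 0ℚ; 1ℚ; _/_; _+_; _*_; -_)
  open import Data.Rational.Properties
  import Data.Nat.Coprimality as Coprime
  open import Data.Maybe using (Maybe; just; nothing)
  open import Relation.Nullary using (yes; no)
  open import Relation.Binary.PropositionalEquality
  open import Tactic.RingSolver.Core.AlmostCommutativeRing using (AlmostCommutativeRing; fromCommutativeRing)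
  open import Tactic.RingSolver using (solve-∀)
  open ≡-Reasoning

  ℚ-ring : AlmostCommutativeRing _ _
  ℚ-ring = fromCommutativeRing +-*-commutativeRing isZero
    where
    isZero : ∀ x → Maybe (0ℚ ≡ x)
    isZero x with 0ℚ ≟ x
    ... | yes p = just p
    ... | no _  = nothing

  +-interchange : ∀ a b c d → (a + b) + (c + d) ≡ (a + c) + (b + d)
  +-interchange = solve-∀ ℚ-ring

  ℕ→ℚ≡mkℚ : ∀ n → ℕ→ℚ n ≡ mkℚ (+ n) 0 (Coprime.sym (Coprime.1-coprimeTo n))
  ℕ→ℚ≡mkℚ n = normalize-coprime (Coprime.sym (Coprime.1-coprimeTo n))

  ℕ→ℚ-+ : ∀ a b → ℕ→ℚ (a ℕ.+ b) ≡ ℕ→ℚ a + ℕ→ℚ b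
  ℕ→ℚ-+ a b = sym (trans (cong₂ _+_ (ℕ→ℚ≡mkℚ a) (ℕ→ℚ≡mkℚ b))
    (/-cong {p₂ = + (a ℕ.+ b)} (cong₂ ℤ._+_ (ℤ.*-identityʳ (+ a)) (ℤ.*-identityʳ (+ b))) refl))

  ℕ→ℚ-* : ∀ a b → ℕ→ℚ (a ℕ.* b) ≡ ℕ→ℚ a * ℕ→ℚ b
  ℕ→ℚ-* a b = sym (trans (cong₂ _*_ (ℕ→ℚ≡mkℚ a) (ℕ→ℚ≡mkℚ b))
    (/-cong {p₂ = + (a ℕ.* b)} (sym (ℤ.pos-* a b)) refl))

  ℕ→ℚ-*-+ : ∀ a b c → ℕ→ℚ (a ℕ.* b ℕ.+ c) ≡ ℕ→ℚ a * ℕ→ℚ b + ℕ→ℚ c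
  ℕ→ℚ-*-+ a b c = trans (ℕ→ℚ-+ (a ℕ.* b) c) (cong (_+ ℕ→ℚ c) (ℕ→ℚ-* a b))

  ℕ→ℚ-*-inverse : ∀ m → ℕ→ℚ (suc m) * (+ 1 / suc m) ≡ 1ℚ
  ℕ→ℚ-*-inverse m =
    trans (cong₂ _*_ (ℕ→ℚ≡mkℚ (suc m)) (normalize-coprime {1} {m} (Coprime.1-coprimeTo (suc m))))
          (*-inverseʳ (mkℚ (+ suc m) 0 (Coprime.sym (Coprime.1-coprimeTo (suc m)))))

  sumBelow-cong-< : ∀ n {f g : ℕ → ℚ} → (∀ i → i < n → f i ≡ g i) → sumBelow n f ≡ sumBelow n g
  sumBelow-cong-< zero    f≗g = refl
  sumBelow-cong-< (suc n) f≗g =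
    cong₂ _+_ (sumBelow-cong-< n (λ i i<n → f≗g i (ℕ.m<n⇒m<1+n i<n))) (f≗g n (ℕ.n<1+n n))

  sumBelow-cong : ∀ n {f g : ℕ → ℚ} → (∀ i → f i ≡ g i) → sumBelow n f ≡ sumBelow n g
  sumBelow-cong n f≗g = sumBelow-cong-< n (λ i _ → f≗g i)

  sumBelow-zero : ∀ n {f : ℕ → ℚ} → (∀ i → i < n → f i ≡ 0ℚ) → sumBelow n f ≡ 0ℚ
  sumBelow-zero n f≗0 = trans (sumBelow-cong-< n f≗0) (zeros n)
    where
    zeros : ∀ n → sumBelow n (λ _ → 0ℚ) ≡ 0ℚ
    zeros zero    = refl
    zeros (suc n) = trans (+-identityʳ _) (zeros n)

  sumBelow-distrib-+ : ∀ n (f g : ℕ → ℚ) → sumBelow n (λ i → f i + g i) ≡ sumBelow n f + sumBelow n g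
  sumBelow-distrib-+ zero    f g = refl
  sumBelow-distrib-+ (suc n) f g = begin
    sumBelow n (λ i → f i + g i) + (f n + g n)       ≡⟨ cong (_+ (f n + g n)) (sumBelow-distrib-+ n f g) ⟩
    (sumBelow n f + sumBelow n g) + (f n + g n)      ≡⟨ +-interchange (sumBelow n f) (sumBelow n g) (f n) (g n) ⟩
    (sumBelow n f + f n) + (sumBelow n g + g n)      ∎

  sumBelow-distribˡ-* : ∀ n c (f : ℕ → ℚ) → sumBelow n (λ i → c * f i) ≡ c * sumBelow n f
  sumBelow-distribˡ-* zero    c f = sym (*-zeroʳ c)
  sumBelow-distribˡ-* (suc n) c f =
    trans (cong (_+ c * f n) (sumBelow-distribˡ-* n c f)) (sym (*-distribˡ-+ c (sumBelow n f) (f n)))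

  sumBelow-neg : ∀ n (f : ℕ → ℚ) → sumBelow n (λ i → - f i) ≡ - sumBelow n f
  sumBelow-neg zero    f = refl
  sumBelow-neg (suc n) f =
    trans (cong (_+ - f n) (sumBelow-neg n f)) (sym (neg-distrib-+ (sumBelow n f) (f n)))

  sumBelow-suc : ∀ n (f : ℕ → ℚ) → sumBelow (suc n) f ≡ f 0 + sumBelow n (λ i → f (suc i))
  sumBelow-suc zero    f = trans (+-identityˡ (f 0)) (sym (+-identityʳ (f 0)))
  sumBelow-suc (suc n) f = trans (cong (_+ f (suc n)) (sumBelow-suc n f)) (+-assoc (f 0) _ _)

  sumBelow-+ : ∀ a b (f : ℕ → ℚ) → sumBelow (a ℕ.+ b) f ≡ sumBelow a f + sumBelow b (λ i → f (a ℕ.+ i))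
  sumBelow-+ a zero    f = trans (cong (λ n → sumBelow n f) (ℕ.+-identityʳ a)) (sym (+-identityʳ _))
  sumBelow-+ a (suc b) f = begin
    sumBelow (a ℕ.+ suc b) f                              ≡⟨ cong (λ n → sumBelow n f) (ℕ.+-suc a b) ⟩
    sumBelow (a ℕ.+ b) f + f (a ℕ.+ b)                    ≡⟨ cong (_+ f (a ℕ.+ b)) (sumBelow-+ a b f) ⟩
    (sumBelow a f + sumBelow b (λ i → f (a ℕ.+ i))) + f (a ℕ.+ b) ≡⟨ +-assoc (sumBelow a f) _ _ ⟩
    sumBelow a f + sumBelow (suc b) (λ i → f (a ℕ.+ i))   ∎

  sumBelow-shift : ∀ n (f : ℕ → ℚ) → f 0 ≡ 0ℚ → f n ≡ 0ℚ →
                   sumBelow n (λ i → f (suc i)) ≡ sumBelow n f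
  sumBelow-shift n f f₀≡0 fₙ≡0 = begin
    tail                  ≡⟨ +-identityˡ tail ⟨
    0ℚ + tail             ≡⟨ cong (_+ tail) f₀≡0 ⟨
    f 0 + tail            ≡⟨ sumBelow-suc n f ⟨
    sumBelow n f + f n    ≡⟨ cong (λ x → sumBelow n f + x) fₙ≡0 ⟩
    sumBelow n f + 0ℚ     ≡⟨ +-identityʳ (sumBelow n f) ⟩
    sumBelow n f          ∎
    where tail = sumBelow n (λ i → f (suc i))

  sumFromTo≡sumBelow : ∀ a b (f : ℕ → ℚ) → a ≤ suc b → (∀ i → i < a → f i ≡ 0ℚ) →
                       sumFromTo a b f ≡ sumBelow (suc b) f
  sumFromTo≡sumBelow a b f a≤1+b f≗0 = begin
    rest                              ≡⟨ +-identityˡ rest ⟨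
    0ℚ + rest                         ≡⟨ cong (_+ rest) (sumBelow-zero a f≗0) ⟨
    sumBelow a f + rest               ≡⟨ sumBelow-+ a (suc b ∸ a) f ⟨
    sumBelow (a ℕ.+ (suc b ∸ a)) f    ≡⟨ cong (λ n → sumBelow n f) (ℕ.m+[n∸m]≡n a≤1+b) ⟩
    sumBelow (suc b) f                ∎
    where rest = sumFromTo a b f

module StirlingSums where
  open import Defs
  open RationalSums
  open import Data.Nat as ℕ using (ℕ; zero; suc; _∸_; _<_; _≤_; _<ᵇ_; s≤s)
  import Data.Nat.Properties as ℕ
  open import Data.Bool using (T; true; false)
  open import Data.Empty using (⊥-elim)
  open import Data.Rational using (ℚ; 0ℚ; 1ℚ; _+_; _*_; -_)
  open import Data.Rational.Properties
  open import Relation.Binary.PropositionalEquality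
  open import Function using (_∘_)
  open import Tactic.RingSolver using (solve-∀)
  open ≡-Reasoning

  stirling1-< : ∀ {n m} → n < m → stirling1 n m ≡ 0
  stirling1-< {zero}  {suc m} _ = refl
  stirling1-< {suc n} {suc m} (s≤s n<m)
    rewrite stirling1-< {n} {suc m} (ℕ.m<n⇒m<1+n n<m) | stirling1-< n<m =
      trans (ℕ.+-identityʳ (n ℕ.* 0)) (ℕ.*-zeroʳ n)

  stirling1-suc-zero : ∀ n → stirling1 (suc n) 0 ≡ 0
  stirling1-suc-zero zero = refl
  stirling1-suc-zero (suc n) rewrite stirling1-suc-zero n = ℕ.*-zeroʳ n

  stirling1Sum : ℕ → (ℕ → ℚ) → ℚ
  stirling1Sum n w = sumBelow (suc n) (λ m → ℕ→ℚ (stirling1 n m) * w m)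

  stirling1Sum-suc : ∀ n w →
    stirling1Sum (suc n) w ≡ stirling1Sum n (λ m → w (suc m)) + ℕ→ℚ n * stirling1Sum n w
  stirling1Sum-suc n w = begin
    stirling1Sum (suc n) w
      ≡⟨ sumBelow-suc (suc n) (λ m → ℕ→ℚ (stirling1 (suc n) m) * w m) ⟩
    ℕ→ℚ (n ℕ.* stirling1 n 0) * w 0 + sumBelow (suc n) (λ m → ℕ→ℚ (stirling1 (suc n) (suc m)) * w (suc m))
      ≡⟨ cong₂ _+_ head (sumBelow-cong (suc n) term) ⟩
    a * f 0 + sumBelow (suc n) (λ m → a * f (suc m) + g m)
      ≡⟨ cong (a * f 0 +_) (sumBelow-distrib-+ (suc n) (λ m → a * f (suc m)) g) ⟩
    a * f 0 + (sumBelow (suc n) (λ m → a * f (suc m)) + G)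
      ≡⟨ cong (λ x → a * f 0 + (x + G)) (sumBelow-distribˡ-* (suc n) a (λ m → f (suc m))) ⟩
    a * f 0 + (a * (F′ + f (suc n)) + G)
      ≡⟨ cong (λ x → a * f 0 + (a * (F′ + ℕ→ℚ x * w (suc n)) + G)) (stirling1-< (ℕ.n<1+n n)) ⟩
    a * f 0 + (a * (F′ + 0ℚ * w (suc n)) + G)
      ≡⟨ regroup a (f 0) F′ (w (suc n)) G ⟩
    G + a * (f 0 + F′)
      ≡⟨ cong (λ x → G + a * x) (sumBelow-suc n f) ⟨
    G + a * stirling1Sum n w ∎
    where
    a = ℕ→ℚ n
    f : ℕ → ℚ
    f m = ℕ→ℚ (stirling1 n m) * w m
    g : ℕ → ℚ
    g m = ℕ→ℚ (stirling1 n m) * w (suc m)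
    G = stirling1Sum n (λ m → w (suc m))
    F′ = sumBelow n (λ m → f (suc m))
    head : ℕ→ℚ (n ℕ.* stirling1 n 0) * w 0 ≡ a * f 0
    head = trans (cong (_* w 0) (ℕ→ℚ-* n (stirling1 n 0))) (*-assoc a _ (w 0))
    term : ∀ m → ℕ→ℚ (stirling1 (suc n) (suc m)) * w (suc m) ≡ a * f (suc m) + g m
    term m = trans (cong (_* w (suc m)) (ℕ→ℚ-*-+ n (stirling1 n (suc m)) (stirling1 n m)))
                   (distrib a (ℕ→ℚ (stirling1 n (suc m))) (ℕ→ℚ (stirling1 n m)) (w (suc m)))
      where distrib : ∀ a b c x → (a * b + c) * x ≡ a * (b * x) + c * x
            distrib = solve-∀ ℚ-ring
    regroup : ∀ a x y z g → a * x + (a * (y + 0ℚ * z) + g) ≡ g + a * (x + y)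
    regroup = solve-∀ ℚ-ring

  signed-stirling1Sum-suc : ∀ m w →
    ℕ→ℚ m * (sgn m * stirling1Sum m w) + sgn (suc m) * stirling1Sum (suc m) w
      ≡ - (sgn m * stirling1Sum m (λ i → w (suc i)))
  signed-stirling1Sum-suc m w = begin
    a * (s * F) + - s * stirling1Sum (suc m) w   ≡⟨ cong (λ x → a * (s * F) + - s * x) (stirling1Sum-suc m w) ⟩
    a * (s * F) + - s * (G + a * F)              ≡⟨ cancel a s F G ⟩
    - (s * G)                                    ∎
    where
    a = ℕ→ℚ m
    s = sgn m
    F = stirling1Sum m w
    G = stirling1Sum m (λ i → w (suc i))
    cancel : ∀ a s F G → a * (s * F) + - s * (G + a * F) ≡ - (s * G)
    cancel = solve-∀ ℚ-ring

  rStirlingAux-zero-≢ : ∀ {r m} → r ≢ m → rStirlingAux r 0 m ≡ 0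
  rStirlingAux-zero-≢ {zero}  {zero}  r≢m = ⊥-elim (r≢m refl)
  rStirlingAux-zero-≢ {zero}  {suc m} r≢m = refl
  rStirlingAux-zero-≢ {suc r} {zero}  r≢m = refl
  rStirlingAux-zero-≢ {suc r} {suc m} r≢m = rStirlingAux-zero-≢ (r≢m ∘ cong suc)

  rStirlingAux-zero-diag : ∀ r → rStirlingAux r 0 r ≡ 1
  rStirlingAux-zero-diag zero    = refl
  rStirlingAux-zero-diag (suc r) = rStirlingAux-zero-diag r

  rStirlingAux-< : ∀ r d {m} → m < r → rStirlingAux r d m ≡ 0
  rStirlingAux-< r zero          m<r = rStirlingAux-zero-≢ (λ r≡m → ℕ.<-irrefl (sym r≡m) m<r)
  rStirlingAux-< r (suc d) {zero}  m<r = refl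
  rStirlingAux-< r (suc d) {suc m} m<r
    rewrite rStirlingAux-< r d m<r | rStirlingAux-< r d {m} (ℕ.<-trans (ℕ.n<1+n m) m<r) =
      trans (ℕ.+-identityʳ (suc m ℕ.* 0)) (ℕ.*-zeroʳ (suc m))

  rStirlingAux-> : ∀ r d {m} → d ℕ.+ r < m → rStirlingAux r d m ≡ 0
  rStirlingAux-> r zero          r<m = rStirlingAux-zero-≢ (λ r≡m → ℕ.<-irrefl r≡m r<m)
  rStirlingAux-> r (suc d) {zero}  ()
  rStirlingAux-> r (suc d) {suc m} (s≤s d+r<m)
    rewrite rStirlingAux-> r d {suc m} (ℕ.m<n⇒m<1+n d+r<m) | rStirlingAux-> r d d+r<m =
      trans (ℕ.+-identityʳ (suc m ℕ.* 0)) (ℕ.*-zeroʳ (suc m))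

  rStirling2-< : ∀ {r} n {m} → m < r → rStirling2 r n m ≡ 0
  rStirling2-< {r} n m<r with n <ᵇ r
  ... | true  = refl
  ... | false = rStirlingAux-< r (n ∸ r) m<r

  rStirling2≡rStirlingAux : ∀ {r n} m → r ≤ n → rStirling2 r n m ≡ rStirlingAux r (n ∸ r) m
  rStirling2≡rStirlingAux {r} {n} m r≤n with n <ᵇ r in n<ᵇr
  ... | true  = ⊥-elim (ℕ.≤⇒≯ r≤n (ℕ.<ᵇ⇒< n r (subst T (sym n<ᵇr) _)))
  ... | false = refl

  sumBelow-rStirlingAux-suc : ∀ r d (h : ℕ → ℚ) →
    sumBelow (suc (suc d ℕ.+ r)) (λ j → ℕ→ℚ (rStirlingAux r (suc d) j) * h j)
      ≡ sumBelow (suc (d ℕ.+ r)) (λ m → ℕ→ℚ (rStirlingAux r d m) * (ℕ→ℚ m * h m + h (suc m)))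
  sumBelow-rStirlingAux-suc r d h = begin
    sumBelow (suc (suc N)) (λ j → a′ j * h j)
      ≡⟨ sumBelow-suc (suc N) (λ j → a′ j * h j) ⟩
    0ℚ * h 0 + sumBelow (suc N) (λ m → a′ (suc m) * h (suc m))
      ≡⟨ cong₂ _+_ (*-zeroˡ (h 0)) (sumBelow-cong (suc N) term) ⟩
    0ℚ + sumBelow (suc N) (λ m → P (suc m) + Q m)
      ≡⟨ +-identityˡ (sumBelow (suc N) (λ m → P (suc m) + Q m)) ⟩
    sumBelow (suc N) (λ m → P (suc m) + Q m)
      ≡⟨ sumBelow-distrib-+ (suc N) (λ m → P (suc m)) Q ⟩
    sumBelow (suc N) (λ m → P (suc m)) + sumBelow (suc N) Q
      ≡⟨ cong (_+ sumBelow (suc N) Q) (sumBelow-shift (suc N) P P₀≡0 P₁₊N≡0) ⟩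
    sumBelow (suc N) P + sumBelow (suc N) Q
      ≡⟨ sumBelow-distrib-+ (suc N) P Q ⟨
    sumBelow (suc N) (λ m → P m + Q m)
      ≡⟨ sumBelow-cong (suc N) (λ m → *-distribˡ-+ (a m) (ℕ→ℚ m * h m) (h (suc m))) ⟨
    sumBelow (suc N) (λ m → a m * (ℕ→ℚ m * h m + h (suc m))) ∎
    where
    N = d ℕ.+ r
    a a′ P Q : ℕ → ℚ
    a m = ℕ→ℚ (rStirlingAux r d m)
    a′ m = ℕ→ℚ (rStirlingAux r (suc d) m)
    P m = a m * (ℕ→ℚ m * h m)
    Q m = a m * h (suc m)
    term : ∀ m → a′ (suc m) * h (suc m) ≡ P (suc m) + Q m
    term m = trans (cong (_* h (suc m)) (ℕ→ℚ-*-+ (suc m) (rStirlingAux r d (suc m)) (rStirlingAux r d m)))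
                   (distrib (ℕ→ℚ (suc m)) (a (suc m)) (a m) (h (suc m)))
      where distrib : ∀ c b a x → (c * b + a) * x ≡ b * (c * x) + a * x
            distrib = solve-∀ ℚ-ring
    P₀≡0 : P 0 ≡ 0ℚ
    P₀≡0 = trans (cong (a 0 *_) (*-zeroˡ (h 0))) (*-zeroʳ (a 0))
    P₁₊N≡0 : P (suc N) ≡ 0ℚ
    P₁₊N≡0 = trans (cong (λ x → ℕ→ℚ x * (ℕ→ℚ (suc N) * h (suc N))) (rStirlingAux-> r d (ℕ.n<1+n N)))
                   (*-zeroˡ (ℕ→ℚ (suc N) * h (suc N)))

  sumBelow-rStirlingAux-stirling1Sum : ∀ r d w →
    sumBelow (suc (d ℕ.+ r)) (λ j → ℕ→ℚ (rStirlingAux r d j) * (sgn j * stirling1Sum j w))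
      ≡ sgn (d ℕ.+ r) * stirling1Sum r (λ m → w (d ℕ.+ m))
  sumBelow-rStirlingAux-stirling1Sum r zero w = begin
    sumBelow r (λ j → a j * h j) + a r * h r
      ≡⟨ cong₂ _+_ (sumBelow-zero r below) (cong (λ x → ℕ→ℚ x * h r) (rStirlingAux-zero-diag r)) ⟩
    0ℚ + 1ℚ * h r
      ≡⟨ trans (+-identityˡ (1ℚ * h r)) (*-identityˡ (h r)) ⟩
    h r ∎
    where
    a h : ℕ → ℚ
    a j = ℕ→ℚ (rStirlingAux r 0 j)
    h j = sgn j * stirling1Sum j w
    below : ∀ j → j < r → a j * h j ≡ 0ℚ
    below j j<r = trans (cong (λ x → ℕ→ℚ x * h j) (rStirlingAux-< r 0 j<r)) (*-zeroˡ (h j))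
  sumBelow-rStirlingAux-stirling1Sum r (suc d) w = begin
    sumBelow (suc (suc N)) (λ j → ℕ→ℚ (rStirlingAux r (suc d) j) * h w j)
      ≡⟨ sumBelow-rStirlingAux-suc r d (h w) ⟩
    sumBelow (suc N) (λ m → a m * (ℕ→ℚ m * h w m + h w (suc m)))
      ≡⟨ sumBelow-cong (suc N) (λ m → trans (cong (a m *_) (signed-stirling1Sum-suc m w))
                                            (sym (neg-distribʳ-* (a m) (h w′ m)))) ⟩
    sumBelow (suc N) (λ m → - (a m * h w′ m))
      ≡⟨ sumBelow-neg (suc N) (λ m → a m * h w′ m) ⟩
    - sumBelow (suc N) (λ m → a m * h w′ m)
      ≡⟨ cong -_ (sumBelow-rStirlingAux-stirling1Sum r d w′) ⟩
    - (sgn N * stirling1Sum r (λ m → w′ (d ℕ.+ m)))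
      ≡⟨ neg-distribˡ-* (sgn N) (stirling1Sum r (λ m → w′ (d ℕ.+ m))) ⟩
    - sgn N * stirling1Sum r (λ m → w′ (d ℕ.+ m)) ∎
    where
    N = d ℕ.+ r
    w′ : ℕ → ℚ
    w′ m = w (suc m)
    a : ℕ → ℚ
    a m = ℕ→ℚ (rStirlingAux r d m)
    h : (ℕ → ℚ) → ℕ → ℚ
    h v j = sgn j * stirling1Sum j v

  sumBelow-rStirling2-stirling1Sum : ∀ r n w → r ≤ n →
    sumBelow (suc n) (λ j → ℕ→ℚ (rStirling2 r n j) * (sgn j * stirling1Sum j w))
      ≡ sgn n * stirling1Sum r (λ m → w (n ∸ r ℕ.+ m))
  sumBelow-rStirling2-stirling1Sum r n w r≤n = begin
    sumBelow (suc n) (λ j → ℕ→ℚ (rStirling2 r n j) * h j)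
      ≡⟨ sumBelow-cong (suc n) (λ j → cong (λ x → ℕ→ℚ x * h j) (rStirling2≡rStirlingAux j r≤n)) ⟩
    sumBelow (suc n) (λ j → ℕ→ℚ (rStirlingAux r (n ∸ r) j) * h j)
      ≡⟨ cong (λ N → sumBelow (suc N) (λ j → ℕ→ℚ (rStirlingAux r (n ∸ r) j) * h j)) n∸r+r≡n ⟨
    sumBelow (suc (n ∸ r ℕ.+ r)) (λ j → ℕ→ℚ (rStirlingAux r (n ∸ r) j) * h j)
      ≡⟨ sumBelow-rStirlingAux-stirling1Sum r (n ∸ r) w ⟩
    sgn (n ∸ r ℕ.+ r) * stirling1Sum r (λ m → w (n ∸ r ℕ.+ m))
      ≡⟨ cong (λ N → sgn N * stirling1Sum r (λ m → w (n ∸ r ℕ.+ m))) n∸r+r≡n ⟩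
    sgn n * stirling1Sum r (λ m → w (n ∸ r ℕ.+ m)) ∎
    where
    h : ℕ → ℚ
    h j = sgn j * stirling1Sum j w
    n∸r+r≡n : n ∸ r ℕ.+ r ≡ n
    n∸r+r≡n = ℕ.m∸n+n≡m r≤n

  *-stirling1Sum≡sumFromTo-1 : ∀ c r w → 1 ≤ r →
    c * stirling1Sum r w ≡ sumFromTo 1 r (λ ℓ → c * w ℓ * ℕ→ℚ (stirling1 r ℓ))
  *-stirling1Sum≡sumFromTo-1 c (suc r) w _ = begin
    c * stirling1Sum (suc r) w
      ≡⟨ sumBelow-distribˡ-* (suc (suc r)) c (λ ℓ → ℕ→ℚ (stirling1 (suc r) ℓ) * w ℓ) ⟨
    sumBelow (suc (suc r)) (λ ℓ → c * (ℕ→ℚ (stirling1 (suc r) ℓ) * w ℓ))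
      ≡⟨ sumBelow-cong (suc (suc r)) (λ ℓ → reorder c (ℕ→ℚ (stirling1 (suc r) ℓ)) (w ℓ)) ⟩
    sumBelow (suc (suc r)) f
      ≡⟨ sumFromTo≡sumBelow 1 (suc r) f (s≤s ℕ.z≤n) f₀≡0 ⟨
    sumFromTo 1 (suc r) f ∎
    where
    f : ℕ → ℚ
    f ℓ = c * w ℓ * ℕ→ℚ (stirling1 (suc r) ℓ)
    reorder : ∀ c s x → c * (s * x) ≡ c * x * s
    reorder = solve-∀ ℚ-ring
    f₀≡0 : ∀ i → i < 1 → f i ≡ 0ℚ
    f₀≡0 zero _ = trans (cong (λ x → c * w 0 * ℕ→ℚ x) (stirling1-suc-zero r)) (*-zeroʳ (c * w 0))
    f₀≡0 (suc i) (s≤s ())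

module NegLogPowers where
  open import Defs
  open RationalSums
  open StirlingSums using (stirling1Sum; stirling1-suc-zero)
  open import Data.Nat as ℕ using (ℕ; zero; suc; _∸_; s≤s)
  import Data.Nat.Properties as ℕ
  open import Data.Integer using (+_)
  open import Data.Rational using (ℚ; 0ℚ; 1ℚ; _/_; _+_; _*_; -_; _-_)
  open import Data.Rational.Properties
  open import Relation.Binary.PropositionalEquality
  open import Tactic.RingSolver using (solve-∀)
  open ≡-Reasoning

  -- On coefficient sequences, xD h, D h and θ h are x h′(x), h′(x) and (1 + x) h′(x).
  xD D θ : Series → Series
  xD h n = ℕ→ℚ n * h n
  D h n = ℕ→ℚ (suc n) * h (suc n)
  θ h n = D h n + xD h n

  ⊛-congʳ : ∀ f {g g′} n → (∀ i → g i ≡ g′ i) → (f ⊛ g) n ≡ (f ⊛ g′) n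
  ⊛-congʳ f n g≗g′ = sumBelow-cong (suc n) (λ i → cong (f i *_) (g≗g′ (n ∸ i)))

  ⊛-distribʳ-+ : ∀ f g h n → ((λ i → f i + g i) ⊛ h) n ≡ (f ⊛ h) n + (g ⊛ h) n
  ⊛-distribʳ-+ f g h n =
    trans (sumBelow-cong (suc n) (λ i → *-distribʳ-+ (h (n ∸ i)) (f i) (g i)))
          (sumBelow-distrib-+ (suc n) (λ i → f i * h (n ∸ i)) (λ i → g i * h (n ∸ i)))

  ⊛-distribˡ-+ : ∀ f g h n → (f ⊛ (λ i → g i + h i)) n ≡ (f ⊛ g) n + (f ⊛ h) n
  ⊛-distribˡ-+ f g h n =
    trans (sumBelow-cong (suc n) (λ i → *-distribˡ-+ (f i) (g (n ∸ i)) (h (n ∸ i))))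
          (sumBelow-distrib-+ (suc n) (λ i → f i * g (n ∸ i)) (λ i → f i * h (n ∸ i)))

  ⊛-negˡ : ∀ f g n → ((λ i → - f i) ⊛ g) n ≡ - (f ⊛ g) n
  ⊛-negˡ f g n =
    trans (sumBelow-cong (suc n) (λ i → sym (neg-distribˡ-* (f i) (g (n ∸ i)))))
          (sumBelow-neg (suc n) (λ i → f i * g (n ∸ i)))

  ⊛-*ʳ : ∀ a f g n → (f ⊛ (λ i → a * g i)) n ≡ a * (f ⊛ g) n
  ⊛-*ʳ a f g n =
    trans (sumBelow-cong (suc n) (λ i → x*[a*y]≡a*[x*y] (f i) a (g (n ∸ i))))
          (sumBelow-distribˡ-* (suc n) a (λ i → f i * g (n ∸ i)))
    where x*[a*y]≡a*[x*y] : ∀ x a y → x * (a * y) ≡ a * (x * y)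
          x*[a*y]≡a*[x*y] = solve-∀ ℚ-ring

  powS-zero-⊛ : ∀ f h n → (powS f 0 ⊛ h) n ≡ h n
  powS-zero-⊛ f h n = begin
    (powS f 0 ⊛ h) n
      ≡⟨ sumBelow-suc n (λ i → powS f 0 i * h (n ∸ i)) ⟩
    1ℚ * h n + sumBelow n (λ i → 0ℚ * h (n ∸ suc i))
      ≡⟨ cong₂ _+_ (*-identityˡ (h n)) (sumBelow-zero n (λ i _ → *-zeroˡ (h (n ∸ suc i)))) ⟩
    h n + 0ℚ
      ≡⟨ +-identityʳ (h n) ⟩
    h n ∎

  ⊛-suc-headˡ : ∀ f g n → f 0 ≡ 0ℚ → (f ⊛ g) (suc n) ≡ ((λ i → f (suc i)) ⊛ g) n
  ⊛-suc-headˡ f g n f₀≡0 = begin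
    (f ⊛ g) (suc n)
      ≡⟨ sumBelow-suc (suc n) (λ i → f i * g (suc n ∸ i)) ⟩
    f 0 * g (suc n) + tail
      ≡⟨ cong (λ x → x * g (suc n) + tail) f₀≡0 ⟩
    0ℚ * g (suc n) + tail
      ≡⟨ trans (cong (_+ tail) (*-zeroˡ (g (suc n)))) (+-identityˡ tail) ⟩
    tail ∎
    where tail = ((λ i → f (suc i)) ⊛ g) n

  ⊛-suc-headʳ : ∀ f g n → g 0 ≡ 0ℚ → (f ⊛ g) (suc n) ≡ (f ⊛ (λ i → g (suc i))) n
  ⊛-suc-headʳ f g n g₀≡0 = begin
    sumBelow (suc n) (λ i → f i * g (suc n ∸ i)) + f (suc n) * g (n ∸ n)
      ≡⟨ cong₂ _+_ (sumBelow-cong-< (suc n) shift) last≡0 ⟩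
    (f ⊛ (λ i → g (suc i))) n + 0ℚ
      ≡⟨ +-identityʳ _ ⟩
    (f ⊛ (λ i → g (suc i))) n ∎
    where
    shift : ∀ i → i ℕ.< suc n → f i * g (suc n ∸ i) ≡ f i * g (suc (n ∸ i))
    shift i (s≤s i≤n) = cong (λ j → f i * g j) (ℕ.+-∸-assoc 1 i≤n)
    last≡0 : f (suc n) * g (n ∸ n) ≡ 0ℚ
    last≡0 = trans (cong (λ j → f (suc n) * g j) (ℕ.n∸n≡0 n))
                   (trans (cong (f (suc n) *_) g₀≡0) (*-zeroʳ (f (suc n))))

  xD-⊛ : ∀ f g n → xD (f ⊛ g) n ≡ (xD f ⊛ g) n + (f ⊛ xD g) n
  xD-⊛ f g n = begin
    ℕ→ℚ n * (f ⊛ g) n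
      ≡⟨ sumBelow-distribˡ-* (suc n) (ℕ→ℚ n) (λ i → f i * g (n ∸ i)) ⟨
    sumBelow (suc n) (λ i → ℕ→ℚ n * (f i * g (n ∸ i)))
      ≡⟨ sumBelow-cong-< (suc n) split ⟩
    sumBelow (suc n) (λ i → xD f i * g (n ∸ i) + f i * xD g (n ∸ i))
      ≡⟨ sumBelow-distrib-+ (suc n) (λ i → xD f i * g (n ∸ i)) (λ i → f i * xD g (n ∸ i)) ⟩
    (xD f ⊛ g) n + (f ⊛ xD g) n ∎
    where
    distrib : ∀ a b x y → (a + b) * (x * y) ≡ a * x * y + x * (b * y)
    distrib = solve-∀ ℚ-ring
    split : ∀ i → i ℕ.< suc n → ℕ→ℚ n * (f i * g (n ∸ i)) ≡ xD f i * g (n ∸ i) + f i * xD g (n ∸ i)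
    split i (s≤s i≤n) = begin
      ℕ→ℚ n * (f i * g (n ∸ i))
        ≡⟨ cong (λ m → ℕ→ℚ m * (f i * g (n ∸ i))) (ℕ.m+[n∸m]≡n i≤n) ⟨
      ℕ→ℚ (i ℕ.+ (n ∸ i)) * (f i * g (n ∸ i))
        ≡⟨ cong (_* (f i * g (n ∸ i))) (ℕ→ℚ-+ i (n ∸ i)) ⟩
      (ℕ→ℚ i + ℕ→ℚ (n ∸ i)) * (f i * g (n ∸ i))
        ≡⟨ distrib (ℕ→ℚ i) (ℕ→ℚ (n ∸ i)) (f i) (g (n ∸ i)) ⟩
      xD f i * g (n ∸ i) + f i * xD g (n ∸ i) ∎

  D-⊛ : ∀ f g n → D (f ⊛ g) n ≡ (D f ⊛ g) n + (f ⊛ D g) n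
  D-⊛ f g n = trans (xD-⊛ f g (suc n))
    (cong₂ _+_ (⊛-suc-headˡ (xD f) g n (*-zeroˡ (f 0))) (⊛-suc-headʳ f (xD g) n (*-zeroˡ (g 0))))

  θ-⊛ : ∀ f g n → θ (f ⊛ g) n ≡ (θ f ⊛ g) n + (f ⊛ θ g) n
  θ-⊛ f g n = begin
    D (f ⊛ g) n + xD (f ⊛ g) n
      ≡⟨ cong₂ _+_ (D-⊛ f g n) (xD-⊛ f g n) ⟩
    ((D f ⊛ g) n + (f ⊛ D g) n) + ((xD f ⊛ g) n + (f ⊛ xD g) n)
      ≡⟨ +-interchange ((D f ⊛ g) n) ((f ⊛ D g) n) ((xD f ⊛ g) n) ((f ⊛ xD g) n) ⟩
    ((D f ⊛ g) n + (xD f ⊛ g) n) + ((f ⊛ D g) n + (f ⊛ xD g) n)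
      ≡⟨ cong₂ _+_ (⊛-distribʳ-+ (D f) (xD f) g n) (⊛-distribˡ-+ f (D g) (xD g) n) ⟨
    (θ f ⊛ g) n + (f ⊛ θ g) n ∎

  θ-powS-zero : ∀ f n → θ (powS f 0) n ≡ 0ℚ
  θ-powS-zero f zero    = refl
  θ-powS-zero f (suc n) =
    trans (cong₂ _+_ (*-zeroʳ (ℕ→ℚ (suc (suc n)))) (*-zeroʳ (ℕ→ℚ (suc n)))) (+-identityˡ 0ℚ)

  θ-negLog1p : ∀ n → θ negLog1p n ≡ - powS negLog1p 0 n
  θ-negLog1p zero    = refl
  θ-negLog1p (suc m) = begin
    ℕ→ℚ (2 ℕ.+ m) * (- s * u₂) + ℕ→ℚ (suc m) * (s * u₁)
      ≡⟨ reorder (ℕ→ℚ (2 ℕ.+ m)) u₂ (ℕ→ℚ (suc m)) u₁ s ⟩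
    - s * (ℕ→ℚ (2 ℕ.+ m) * u₂) + s * (ℕ→ℚ (suc m) * u₁)
      ≡⟨ cong₂ (λ x y → - s * x + s * y) (ℕ→ℚ-*-inverse (suc m)) (ℕ→ℚ-*-inverse m) ⟩
    - s * 1ℚ + s * 1ℚ
      ≡⟨ trans (cong₂ _+_ (*-identityʳ (- s)) (*-identityʳ s)) (+-inverseˡ s) ⟩
    0ℚ ∎
    where
    s = sgn (suc m)
    u₁ = + 1 / suc m
    u₂ = + 1 / (2 ℕ.+ m)
    reorder : ∀ a x b y s → a * (- s * x) + b * (s * y) ≡ - s * (a * x) + s * (b * y)
    reorder = solve-∀ ℚ-ring

  θ-negLog1p-pow : ∀ m n → θ (powS negLog1p (suc m)) n ≡ - (ℕ→ℚ (suc m) * powS negLog1p m n)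
  θ-negLog1p-pow m n = begin
    θ (L ⊛ q m) n
      ≡⟨ θ-⊛ L (q m) n ⟩
    (θ L ⊛ q m) n + (L ⊛ θ (q m)) n
      ≡⟨ cong (_+ (L ⊛ θ (q m)) n) θL⊛q ⟩
    - q m n + (L ⊛ θ (q m)) n
      ≡⟨ cong (λ x → - q m n + x) (L⊛θq m) ⟩
    - q m n + - (ℕ→ℚ m * q m n)
      ≡⟨ collect (ℕ→ℚ m) (q m n) ⟩
    - ((1ℚ + ℕ→ℚ m) * q m n)
      ≡⟨ cong (λ a → - (a * q m n)) (ℕ→ℚ-+ 1 m) ⟨
    - (ℕ→ℚ (suc m) * q m n) ∎
    where
    L = negLog1p
    q = powS negLog1p
    θL⊛q : (θ L ⊛ q m) n ≡ - q m n
    θL⊛q = trans (sumBelow-cong (suc n) (λ i → cong (_* q m (n ∸ i)) (θ-negLog1p i)))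
                 (trans (⊛-negˡ (q 0) (q m) n) (cong -_ (powS-zero-⊛ L (q m) n)))
    L⊛θq : ∀ m → (L ⊛ θ (q m)) n ≡ - (ℕ→ℚ m * q m n)
    L⊛θq zero     = begin
      (L ⊛ θ (q 0)) n
        ≡⟨ sumBelow-zero (suc n) (λ i _ → trans (cong (L i *_) (θ-powS-zero L (n ∸ i))) (*-zeroʳ (L i))) ⟩
      0ℚ
        ≡⟨ cong -_ (*-zeroˡ (q 0 n)) ⟨
      - (0ℚ * q 0 n) ∎
    L⊛θq (suc m′) = begin
      (L ⊛ θ (q (suc m′))) n
        ≡⟨ ⊛-congʳ L n (λ i → trans (θ-negLog1p-pow m′ i) (neg-distribˡ-* a (q m′ i))) ⟩
      (L ⊛ (λ i → - a * q m′ i)) n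
        ≡⟨ ⊛-*ʳ (- a) L (q m′) n ⟩
      - a * q (suc m′) n
        ≡⟨ neg-distribˡ-* a (q (suc m′) n) ⟨
      - (a * q (suc m′) n) ∎
      where a = ℕ→ℚ (suc m′)
    collect : ∀ a x → - x + - (a * x) ≡ - ((1ℚ + a) * x)
    collect = solve-∀ ℚ-ring

  negLog1p-pow-suc : ∀ m n → ℕ→ℚ (suc n) * powS negLog1p (suc m) (suc n)
    ≡ - (ℕ→ℚ (suc m) * powS negLog1p m n) - ℕ→ℚ n * powS negLog1p (suc m) n
  negLog1p-pow-suc m n = begin
    x            ≡⟨ x≡x+y-y x y ⟩
    (x + y) - y  ≡⟨ cong (_- y) (θ-negLog1p-pow m n) ⟩
    - (ℕ→ℚ (suc m) * powS negLog1p m n) - y ∎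
    where
    x = ℕ→ℚ (suc n) * powS negLog1p (suc m) (suc n)
    y = ℕ→ℚ n * powS negLog1p (suc m) n
    x≡x+y-y : ∀ x y → x ≡ (x + y) - y
    x≡x+y-y = solve-∀ ℚ-ring

  negLog1p-pow-coeff : ∀ n m → factℚ n * invFact m * powS negLog1p m n ≡ sgn n * ℕ→ℚ (stirling1 n m)
  negLog1p-pow-coeff zero    zero    = refl
  negLog1p-pow-coeff zero    (suc m) =
    trans (cong (λ x → 1ℚ * invFact (suc m) * (0ℚ + x)) (*-zeroˡ (powS negLog1p m 0)))
          (*-zeroʳ (1ℚ * invFact (suc m)))
  negLog1p-pow-coeff (suc n) zero    = begin
    factℚ (suc n) * 1ℚ * 0ℚ             ≡⟨ *-zeroʳ (factℚ (suc n) * 1ℚ) ⟩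
    0ℚ                                  ≡⟨ *-zeroʳ (sgn (suc n)) ⟨
    sgn (suc n) * ℕ→ℚ 0                 ≡⟨ cong (λ s → sgn (suc n) * ℕ→ℚ s) (stirling1-suc-zero n) ⟨
    sgn (suc n) * ℕ→ℚ (stirling1 (suc n) 0) ∎
  negLog1p-pow-coeff (suc n) (suc m) = begin
    factℚ n * ℕ→ℚ (suc n) * (I * u) * q (suc m) (suc n)
      ≡⟨ reassoc (factℚ n) (ℕ→ℚ (suc n)) (I * u) (q (suc m) (suc n)) ⟩
    factℚ n * (I * u) * (ℕ→ℚ (suc n) * q (suc m) (suc n))
      ≡⟨ cong (factℚ n * (I * u) *_) (negLog1p-pow-suc m n) ⟩
    factℚ n * (I * u) * (- (ℕ→ℚ (suc m) * q m n) - ℕ→ℚ n * q (suc m) n)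
      ≡⟨ expand (factℚ n) I u (ℕ→ℚ (suc m)) (q m n) (ℕ→ℚ n) (q (suc m) n) ⟩
    - (ℕ→ℚ (suc m) * u * (factℚ n * I * q m n)) - ℕ→ℚ n * (factℚ n * (I * u) * q (suc m) n)
      ≡⟨ cong₂ (λ a b → - (a * b) - ℕ→ℚ n * (factℚ n * (I * u) * q (suc m) n))
               (ℕ→ℚ-*-inverse m) (negLog1p-pow-coeff n m) ⟩
    - (1ℚ * (sgn n * ℕ→ℚ (stirling1 n m))) - ℕ→ℚ n * (factℚ n * invFact (suc m) * q (suc m) n)
      ≡⟨ cong (λ b → - (1ℚ * (sgn n * ℕ→ℚ (stirling1 n m))) - ℕ→ℚ n * b) (negLog1p-pow-coeff n (suc m)) ⟩
    - (1ℚ * (sgn n * ℕ→ℚ (stirling1 n m))) - ℕ→ℚ n * (sgn n * ℕ→ℚ (stirling1 n (suc m)))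
      ≡⟨ collect (sgn n) (ℕ→ℚ (stirling1 n m)) (ℕ→ℚ n) (ℕ→ℚ (stirling1 n (suc m))) ⟩
    - sgn n * (ℕ→ℚ n * ℕ→ℚ (stirling1 n (suc m)) + ℕ→ℚ (stirling1 n m))
      ≡⟨ cong (λ x → - sgn n * x) (ℕ→ℚ-*-+ n (stirling1 n (suc m)) (stirling1 n m)) ⟨
    - sgn n * ℕ→ℚ (n ℕ.* stirling1 n (suc m) ℕ.+ stirling1 n m) ∎
    where
    q = powS negLog1p
    I = invFact m
    u = + 1 / suc m
    reassoc : ∀ F a b x → F * a * b * x ≡ F * b * (a * x)
    reassoc = solve-∀ ℚ-ring
    expand : ∀ F I u a x b y → F * (I * u) * (- (a * x) - b * y) ≡ - (a * u * (F * I * x)) - b * (F * (I * u) * y)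
    expand = solve-∀ ℚ-ring
    collect : ∀ s t a v → - (1ℚ * (s * t)) - a * (s * v) ≡ - s * (a * v + t)
    collect = solve-∀ ℚ-ring

  egf-negLog1p-substitution : ∀ (w : ℕ → ℚ) n →
    factℚ n * sumFromTo 0 n (λ m → invFact m * w m * powS negLog1p m n) ≡ sgn n * stirling1Sum n w
  egf-negLog1p-substitution w n = begin
    factℚ n * sumBelow (suc n) (λ m → invFact m * w m * powS negLog1p m n)
      ≡⟨ sumBelow-distribˡ-* (suc n) (factℚ n) (λ m → invFact m * w m * powS negLog1p m n) ⟨
    sumBelow (suc n) (λ m → factℚ n * (invFact m * w m * powS negLog1p m n))
      ≡⟨ sumBelow-cong (suc n) term ⟩
    sumBelow (suc n) (λ m → sgn n * (ℕ→ℚ (stirling1 n m) * w m))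
      ≡⟨ sumBelow-distribˡ-* (suc n) (sgn n) (λ m → ℕ→ℚ (stirling1 n m) * w m) ⟩
    sgn n * stirling1Sum n w ∎
    where
    reorder : ∀ F I x p → F * (I * x * p) ≡ F * I * p * x
    reorder = solve-∀ ℚ-ring
    term : ∀ m → factℚ n * (invFact m * w m * powS negLog1p m n) ≡ sgn n * (ℕ→ℚ (stirling1 n m) * w m)
    term m = begin
      factℚ n * (invFact m * w m * powS negLog1p m n)  ≡⟨ reorder (factℚ n) (invFact m) (w m) (powS negLog1p m n) ⟩
      factℚ n * invFact m * powS negLog1p m n * w m    ≡⟨ cong (_* w m) (negLog1p-pow-coeff n m) ⟩
      sgn n * ℕ→ℚ (stirling1 n m) * w m                ≡⟨ *-assoc (sgn n) (ℕ→ℚ (stirling1 n m)) (w m) ⟩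
      sgn n * (ℕ→ℚ (stirling1 n m) * w m)              ∎

open import Defs
open import Data.Nat using (ℕ; _≤_; _∸_; _+_)
open import Data.Integer using (ℤ)
open import Data.Rational using (ℚ; _*_)
open import Relation.Binary.PropositionalEquality using (_≡_)
open import Data.Nat using (suc; _<_)
open import Data.Nat.Properties using (m≤n⇒m≤1+n)
open import Data.Rational using (0ℚ)
open import Data.Rational.Properties using (*-zeroˡ)
open import Relation.Binary.PropositionalEquality using (cong; trans; module ≡-Reasoning)
open RationalSums using (sumBelow-cong; sumFromTo≡sumBelow)
open StirlingSums
open NegLogPowers using (egf-negLog1p-substitution)
open ≡-Reasoning

theorem3 : (n r : ℕ) (k : ℤ) → 1 ≤ r → r ≤ n →
    sumFromTo r n (λ j → ℕ→ℚ (rStirling2 r n j) * polyCauchy2 k j)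
      ≡ sumFromTo 1 r (λ ℓ → sgn n * invPowZ k (n ∸ r + ℓ) * ℕ→ℚ (stirling1 r ℓ))
theorem3 n r k 1≤r r≤n = begin
  sumFromTo r n (λ j → S j * polyCauchy2 k j)
    ≡⟨ sumFromTo≡sumBelow r n (λ j → S j * polyCauchy2 k j) (m≤n⇒m≤1+n r≤n) below-r ⟩
  sumBelow (suc n) (λ j → S j * polyCauchy2 k j)
    ≡⟨ sumBelow-cong (suc n) (λ j → cong (S j *_) (egf-negLog1p-substitution (invPowZ k) j)) ⟩
  sumBelow (suc n) (λ j → S j * (sgn j * stirling1Sum j (invPowZ k)))
    ≡⟨ sumBelow-rStirling2-stirling1Sum r n (invPowZ k) r≤n ⟩
  sgn n * stirling1Sum r (λ m → invPowZ k (n ∸ r + m))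
    ≡⟨ *-stirling1Sum≡sumFromTo-1 (sgn n) r (λ m → invPowZ k (n ∸ r + m)) 1≤r ⟩
  sumFromTo 1 r (λ ℓ → sgn n * invPowZ k (n ∸ r + ℓ) * ℕ→ℚ (stirling1 r ℓ)) ∎
  where
  S : ℕ → ℚ
  S j = ℕ→ℚ (rStirling2 r n j)
  below-r : ∀ j → j < r → S j * polyCauchy2 k j ≡ 0ℚ
  below-r j j<r =
    trans (cong (λ s → ℕ→ℚ s * polyCauchy2 k j) (rStirling2-< n j<r)) (*-zeroˡ (polyCauchy2 k j))
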